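{- If $H \in \mathcal{H}_2$, then $\tau_t(H) \le \frac{2}{5}(n_H + m_H)$.
   Context: $\mathcal{H}_2$ is the class of all simple graphs with no isolated vertices and no isolated edges (an isolated edge is an edge sharing no vertex with any other edge); $n_H$ and $m_H$ are the numbers of vertices and edges of $H$. A total transversal of $H$ is a vertex set $T$ meeting every edge such that every vertex of $T$ has a neighbor in $T$; $\tau_t(H)$ is the minimum size of a total transversal. -}

module Defs where

open import Data.Nat using (ℕ; zero; suc; _+_; _*_; _≤_; _<_)
open import Data.Fin using (Fin; toℕ)
open import Data.Bool using (Bool; true; false; T)
open import Data.Product using (Σ; ∃; ∃-syntax; _×_; _,_)
open import Data.Fin.Subset using (Subset; _∈_; ∣_∣)
open import Data.List using (List; length; filter; allFin; cartesianProduct)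
open import Relation.Binary.PropositionalEquality using (_≡_)
open import Relation.Nullary using (¬_)
open import Relation.Nullary.Decidable using (_×-dec_; T?)
open import Data.Nat using (_<?_)
open import Data.Sum using (_⊎_)

record Graph (n : ℕ) : Set where
  field
    adj   : Fin n → Fin n → Bool
    sym   : ∀ u v → adj u v ≡ adj v u
    irrefl : ∀ v → adj v v ≡ false

open Graph public

Adj : ∀ {n} → Graph n → Fin n → Fin n → Set
Adj G u v = T (adj G u v)

edgeList : ∀ {n} → Graph n → List (Fin n × Fin n)
edgeList {n} G =
  filter (λ { (u , v) → (toℕ u <? toℕ v) ×-dec T? (adj G u v) })
         (cartesianProduct (allFin n) (allFin n))

numEdges : ∀ {n} → Graph n → ℕ
numEdges G = length (edgeList G)

NoIsolatedVertex : ∀ {n} → Graph n → Set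
NoIsolatedVertex {n} G = ∀ (v : Fin n) → ∃[ u ] Adj G v u

NoIsolatedEdge : ∀ {n} → Graph n → Set
NoIsolatedEdge {n} G = ∀ (u v : Fin n) → Adj G u v →
  ∃[ w ] ((Adj G u w × ¬ (w ≡ v)) ⊎ (Adj G v w × ¬ (w ≡ u)))

InH2 : ∀ {n} → Graph n → Set
InH2 G = NoIsolatedVertex G × NoIsolatedEdge G

IsTransversal : ∀ {n} → Graph n → Subset n → Set
IsTransversal {n} G S = ∀ (u v : Fin n) → Adj G u v → (u ∈ S) ⊎ (v ∈ S)

IsTotal : ∀ {n} → Graph n → Subset n → Set
IsTotal {n} G S = ∀ (v : Fin n) → v ∈ S → ∃[ u ] (u ∈ S × Adj G v u)

IsTotalTransversal : ∀ {n} → Graph n → Subset n → Set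
IsTotalTransversal G S = IsTransversal G S × IsTotal G S

-- Among total transversals S, take one that is optimal for the order "fewer vertices, then
-- larger degree sum over S"; V(H) itself is one, since H has no isolated vertex. Then discharge:
-- every vertex v starts with charge 2 + deg v, 2n + 2m in total, and each vertex of S must end
-- with at least 5. A vertex outside S has all its neighbours in S and sends each of them 3, 2 or
-- 1 according as its degree is 1, 2 or at least 3; a vertex of S with exactly one neighbour in S
-- passes its excess over 5 on to that neighbour. A vertex of S of degree at least 3, or with a
-- neighbour outside S, keeps enough. The remaining vertices v of S have degree 1 or 2 and all
-- their neighbours in S: either some neighbour t is private (v is its only neighbour in S) and
-- passes v enough, or removing v or t, or swapping v or t for a neighbour of t outside S, gives a
-- better total transversal.
module Submission where

open import Defs
open import Data.Nat using (ℕ; _+_; _*_; _≤_)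
open import Data.Product using (∃-syntax; _×_)
open import Data.Fin.Subset using (Subset; ∣_∣)

open import Data.Nat.Properties hiding (_≟_)
open import Algebra.Properties.Semiring.Sum +-*-semiring
  using (sum; sum-cong-≗; sum-remove; sum-replicate-zero; ∑-distrib-+; ∑-comm; *-distribˡ-sum)
open import Algebra.Properties.CommutativeSemigroup +-commutativeSemigroup using (x∙yz≈y∙xz)
open import Data.Bool using (Bool; true; false; if_then_else_; _∧_; not)
open import Data.Bool.Properties using (T-≡) renaming (_≟_ to _≟ᵇ_)
open import Data.Empty using (⊥-elim)
open import Data.Fin using (Fin; zero; suc; toℕ; punchIn)
open import Data.Fin.Properties using (_≟_; toℕ-injective; punchInᵢ≢i)
open import Data.Fin.Subset using (_∈_)
open import Data.List using (List; _++_; length; filter; allFin; cartesianProduct; tabulate; map)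
open import Data.List.Properties using (filter-++; length-++; map-tabulate)
open import Data.Nat using (zero; suc; _∸_; _<_; _<?_; _≡ᵇ_; z≤n; s≤s)
open import Data.Nat.Induction using (<-wellFounded)
open import Data.Product using (_,_; proj₁; proj₂)
open import Data.Sum using (_⊎_; inj₁; inj₂)
import Data.Sum
import Data.Vec as Vec
import Data.Vec.Properties as Vec
open import Data.Vec.Functional using (updateAt; removeAt)
open import Data.Vec.Functional.Properties using (updateAt-updates; updateAt-minimal)
open import Function using (const; id; case_of_; _∘_; Equivalence)
open import Induction.WellFounded using (Acc; acc)
open import Relation.Binary.Definitions using (tri<; tri≈; tri>)
open import Relation.Binary.PropositionalEquality
  using (_≡_; _≢_; _≗_; refl; trans; cong; cong₂; subst; module ≡-Reasoning)
import Relation.Binary.PropositionalEquality as ≡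
open import Relation.Nullary using (yes; no; does)
open import Relation.Nullary.Decidable using (dec-true; dec-false; _×-dec_; T?)
open import Relation.Unary using (Pred; Decidable)

variable
  n : ℕ

m+[n∸m]≤o : ∀ {m n o} → m ≤ o → n ≤ o → m + (n ∸ m) ≤ o
m+[n∸m]≤o {m} {n} {o} m≤o n≤o with ≤-total m n
... | inj₁ m≤n = subst (_≤ o) (≡.sym (m+[n∸m]≡n m≤n)) n≤o
... | inj₂ n≤m = subst (λ k → m + k ≤ o) (≡.sym (m≤n⇒m∸n≡0 n≤m))
                       (subst (_≤ o) (≡.sym (+-identityʳ m)) m≤o)

1≤⇒[≡1⊎≡2]⊎3≤ : ∀ {k} → 1 ≤ k → (k ≡ 1 ⊎ k ≡ 2) ⊎ 3 ≤ k
1≤⇒[≡1⊎≡2]⊎3≤ {1}                 _ = inj₁ (inj₁ refl)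
1≤⇒[≡1⊎≡2]⊎3≤ {2}                 _ = inj₁ (inj₂ refl)
1≤⇒[≡1⊎≡2]⊎3≤ {suc (suc (suc k))} _ = inj₂ (s≤s (s≤s (s≤s z≤n)))

≡ᵇ1⇒≡1 : ∀ {k} → (k ≡ᵇ 1) ≡ true → k ≡ 1
≡ᵇ1⇒≡1 {k} e = ≡ᵇ⇒≡ k 1 (Equivalence.from T-≡ e)

≢ᵇ1⇒2≤ : ∀ {k} → (k ≡ᵇ 1) ≡ false → 1 ≤ k → 2 ≤ k
≢ᵇ1⇒2≤ {suc (suc k)} _ _ = s≤s (s≤s z≤n)

≡true⊎≡false : ∀ b → b ≡ true ⊎ b ≡ false
≡true⊎≡false true  = inj₁ refl
≡true⊎≡false false = inj₂ refl

∧-intro : ∀ {a b} → a ≡ true → b ≡ true → a ∧ b ≡ true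
∧-intro refl refl = refl

∧-elim : ∀ {a b} → a ∧ b ≡ true → a ≡ true × b ≡ true
∧-elim {true} {true} _ = refl , refl

∧-not-elim : ∀ {a b} → a ∧ not b ≡ true → a ≡ true × b ≡ false
∧-not-elim {true} {false} _ = refl , refl

sequence-⊎ : ∀ {p b} {P : Fin n → Set p} {B : Set b} → (∀ i → P i ⊎ B) → (∀ i → P i) ⊎ B
sequence-⊎ {zero}  f = inj₁ λ ()
sequence-⊎ {suc n} f with f zero | sequence-⊎ (λ i → f (suc i))
... | inj₂ b  | _       = inj₂ b
... | inj₁ _  | inj₂ b  = inj₂ b
... | inj₁ p₀ | inj₁ ps = inj₁ λ { zero → p₀ ; (suc i) → ps i }

sum-mono : {f g : Fin n → ℕ} → (∀ x → f x ≤ g x) → sum f ≤ sum g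
sum-mono {zero}  f≤g = z≤n
sum-mono {suc n} f≤g = +-mono-≤ (f≤g zero) (sum-mono (λ x → f≤g (suc x)))

≤-sum : (f : Fin n → ℕ) (x : Fin n) → f x ≤ sum f
≤-sum f zero    = m≤m+n (f zero) _
≤-sum f (suc x) = ≤-trans (≤-sum (λ y → f (suc y)) x) (m≤n+m _ (f zero))

sum-const : ∀ n c → sum {n} (const c) ≡ n * c
sum-const zero    c = refl
sum-const (suc n) c = cong (c +_) (sum-const n c)

sum-pos⇒∃-pos : (f : Fin n → ℕ) → 0 < sum f → ∃[ x ] 0 < f x
sum-pos⇒∃-pos {suc n} f 0<Σ with f zero in eq
... | suc _ = zero , subst (0 <_) (≡.sym eq) (s≤s z≤n)
... | zero  = let x , 0<fx = sum-pos⇒∃-pos (λ y → f (suc y)) 0<Σ in suc x , 0<fx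

sum-agree-except : {f g : Fin n → ℕ} (w : Fin n) → (∀ y → y ≢ w → f y ≡ g y) →
                   g w + sum f ≡ f w + sum g
sum-agree-except {suc n} {f} {g} w f≗g = begin
  g w + sum f                      ≡⟨ cong (g w +_) (sum-remove {i = w} f) ⟩
  g w + (f w + sum (removeAt f w)) ≡⟨ x∙yz≈y∙xz (g w) (f w) _ ⟩
  f w + (g w + sum (removeAt f w)) ≡⟨ cong (λ s → f w + (g w + s)) (sum-cong-≗ agree) ⟩
  f w + (g w + sum (removeAt g w)) ≡⟨ cong (f w +_) (sum-remove {i = w} g) ⟨
  f w + sum g                      ∎
  where
  open ≡-Reasoning
  agree : removeAt f w ≗ removeAt g w
  agree j = f≗g (punchIn w j) (punchInᵢ≢i w j)

-- Vertex sets are Boolean functions on Fin n; they become a Subset n only at the very end.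
_[_]≔_ : (Fin n → Bool) → Fin n → Bool → Fin n → Bool
S [ w ]≔ b = updateAt S w (const b)

∈∉⇒≢ : (S : Fin n → Bool) {x y : Fin n} → S x ≡ true → S y ≡ false → x ≢ y
∈∉⇒≢ S Sx Sy refl = case trans (≡.sym Sx) Sy of λ ()

sumOver : (Fin n → Bool) → (Fin n → ℕ) → ℕ
sumOver S h = sum (λ x → if S x then h x else 0)

count : (Fin n → Bool) → ℕ
count S = sumOver S (const 1)

sumOver-update : (S : Fin n → Bool) (h : Fin n → ℕ) (w : Fin n) (b : Bool) →
  (if b then h w else 0) + sumOver S h ≡ (if S w then h w else 0) + sumOver (S [ w ]≔ b) h
sumOver-update S h w b =
  subst (λ c → (if c then h w else 0) + sumOver S h ≡ (if S w then h w else 0) + sumOver S′ h)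
        (updateAt-updates w S)
        (sum-agree-except w agree)
  where
  S′ = S [ w ]≔ b
  agree : ∀ y → y ≢ w → (if S y then h y else 0) ≡ (if S′ y then h y else 0)
  agree y y≢w = cong (λ c → if c then h y else 0) (≡.sym (updateAt-minimal y w S y≢w))

sumOver-remove : (S : Fin n → Bool) (h : Fin n → ℕ) {w : Fin n} → S w ≡ true →
                 sumOver S h ≡ h w + sumOver (S [ w ]≔ false) h
sumOver-remove S h {w} Sw =
  subst (λ c → sumOver S h ≡ (if c then h w else 0) + sumOver (S [ w ]≔ false) h) Sw
        (sumOver-update S h w false)

sumOver-insert : (S : Fin n → Bool) (h : Fin n → ℕ) {w : Fin n} → S w ≡ false →
                 h w + sumOver S h ≡ sumOver (S [ w ]≔ true) h
sumOver-insert S h {w} Sw =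
  subst (λ c → h w + sumOver S h ≡ (if c then h w else 0) + sumOver (S [ w ]≔ true) h) Sw
        (sumOver-update S h w true)

sumOver-monoʳ : (S : Fin n → Bool) {h k : Fin n → ℕ} → (∀ x → h x ≤ k x) →
                sumOver S h ≤ sumOver S k
sumOver-monoʳ S h≤k = sum-mono λ x → lemma (S x) (h≤k x)
  where
  lemma : ∀ b {p q} → p ≤ q → (if b then p else 0) ≤ (if b then q else 0)
  lemma true  p≤q = p≤q
  lemma false _   = z≤n

sumOver≤sum : (S : Fin n → Bool) (h : Fin n → ℕ) → sumOver S h ≤ sum h
sumOver≤sum S h = sum-mono λ x → lemma (S x)
  where
  lemma : ∀ b {p} → (if b then p else 0) ≤ p
  lemma true  = ≤-refl
  lemma false = z≤n

sumOver-const : (S : Fin n → Bool) (c : ℕ) → sumOver S (const c) ≡ c * count S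
sumOver-const S c =
  trans (sum-cong-≗ λ x → lemma (S x)) (≡.sym (*-distribˡ-sum c (λ x → if S x then 1 else 0)))
  where
  lemma : ∀ b → (if b then c else 0) ≡ c * (if b then 1 else 0)
  lemma true  = ≡.sym (*-identityʳ c)
  lemma false = ≡.sym (*-zeroʳ c)

count-split : (P Q : Fin n → Bool) →
              count (λ x → P x ∧ Q x) + count (λ x → P x ∧ not (Q x)) ≡ count P
count-split P Q = trans
  (≡.sym (∑-distrib-+ (λ x → if P x ∧ Q x then 1 else 0)
                      (λ x → if P x ∧ not (Q x) then 1 else 0)))
  (sum-cong-≗ λ x → lemma (P x) (Q x))
  where
  lemma : ∀ p q → (if p ∧ q then 1 else 0) + (if p ∧ not q then 1 else 0) ≡ (if p then 1 else 0)
  lemma true  true  = refl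
  lemma true  false = refl
  lemma false _     = refl

count-remove : (S : Fin n → Bool) {w : Fin n} → S w ≡ true →
               count S ≡ suc (count (S [ w ]≔ false))
count-remove S = sumOver-remove S (const 1)

∈⇒count-pos : (S : Fin n → Bool) {x : Fin n} → S x ≡ true → 0 < count S
∈⇒count-pos S Sx rewrite count-remove S Sx = s≤s z≤n

count≡0⇒∉ : (S : Fin n → Bool) → count S ≡ 0 → ∀ x → S x ≡ false
count≡0⇒∉ S #S≡0 x with S x in Sx
... | false = refl
... | true  = ⊥-elim (<-irrefl (≡.sym #S≡0) (∈⇒count-pos S Sx))

count-pos⇒∈ : (S : Fin n → Bool) → 0 < count S → ∃[ x ] S x ≡ true
count-pos⇒∈ S 0<#S = let x , 0<Sx = sum-pos⇒∃-pos _ 0<#S in x , lemma (S x) 0<Sx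
  where
  lemma : ∀ b → 0 < (if b then 1 else 0) → b ≡ true
  lemma true _ = refl

count≡1⇒unique : (S : Fin n → Bool) → count S ≡ 1 →
                 ∀ {x y} → S x ≡ true → S y ≡ true → x ≡ y
count≡1⇒unique S #S≡1 {x} {y} Sx Sy with y ≟ x
... | yes y≡x = ≡.sym y≡x
... | no  y≢x = case trans (≡.sym (trans (updateAt-minimal y x S y≢x) Sy)) nothing-left of λ ()
  where
  nothing-left : (S [ x ]≔ false) y ≡ false
  nothing-left =
    count≡0⇒∉ (S [ x ]≔ false) (suc-injective (trans (≡.sym (count-remove S Sx)) #S≡1)) y

count≥2⇒other : (S : Fin n → Bool) → 2 ≤ count S → ∀ y → ∃[ x ] (x ≢ y × S x ≡ true)
count≥2⇒other S 2≤#S y with S y in Sy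
... | false = let x , Sx = count-pos⇒∈ S (≤-trans (s≤s z≤n) 2≤#S) in x , ∈∉⇒≢ S Sx Sy , Sx
... | true  with count-pos⇒∈ (S [ y ]≔ false) (≤-pred (subst (2 ≤_) (count-remove S Sy) 2≤#S))
...   | x , S⁻x = x , x≢y , trans (≡.sym (updateAt-minimal x y S x≢y)) S⁻x
  where
  x≢y : x ≢ y
  x≢y refl = case trans (≡.sym S⁻x) (updateAt-updates x S) of λ ()

sumOver-empty : (S : Fin n → Bool) (h : Fin n → ℕ) → count S ≡ 0 → sumOver S h ≡ 0
sumOver-empty {n} S h #S≡0 =
  trans (sum-cong-≗ λ x → cong (λ b → if b then h x else 0) (count≡0⇒∉ S #S≡0 x))
        (sum-replicate-zero n)

sumOver-unique : (S : Fin n → Bool) (h : Fin n → ℕ) → count S ≡ 1 → ∀ {w} → S w ≡ true →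
                 sumOver S h ≡ h w
sumOver-unique S h #S≡1 {w} Sw = begin
  sumOver S h                      ≡⟨ sumOver-remove S h Sw ⟩
  h w + sumOver (S [ w ]≔ false) h ≡⟨ cong (h w +_) (sumOver-empty _ h (suc-injective #S⁻)) ⟩
  h w + 0                          ≡⟨ +-identityʳ (h w) ⟩
  h w                              ∎
  where
  open ≡-Reasoning
  #S⁻ : suc (count (S [ w ]≔ false)) ≡ 1
  #S⁻ = trans (≡.sym (count-remove S Sw)) #S≡1

module _ {a p} {A : Set a} {P : Pred A p} (P? : Decidable P) where

  length-filter-tabulate : (f : Fin n → A) →
                           length (filter P? (tabulate f)) ≡ count (λ i → does (P? (f i)))
  length-filter-tabulate {zero}  f = refl
  length-filter-tabulate {suc n} f with does (P? (f zero))
  ... | true  = cong suc (length-filter-tabulate (λ i → f (suc i)))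
  ... | false = length-filter-tabulate (λ i → f (suc i))

module _ {a b p} {A : Set a} {B : Set b} {P : Pred (A × B) p} (P? : Decidable P) where

  length-filter-cartesianProduct : (f : Fin n → A) (ys : List B) →
    length (filter P? (cartesianProduct (tabulate f) ys))
      ≡ sum (λ i → length (filter P? (map (f i ,_) ys)))
  length-filter-cartesianProduct {zero}  f ys = refl
  length-filter-cartesianProduct {suc n} f ys = begin
    length (filter P? (row ++ rest))               ≡⟨ cong length (filter-++ P? row rest) ⟩
    length (filter P? row ++ filter P? rest)       ≡⟨ length-++ (filter P? row) ⟩
    length (filter P? row) + length (filter P? rest)
      ≡⟨ cong (length (filter P? row) +_) (length-filter-cartesianProduct (λ i → f (suc i)) ys) ⟩
    sum (λ i → length (filter P? (map (f i ,_) ys))) ∎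
    where
    open ≡-Reasoning
    row  = map (f zero ,_) ys
    rest = cartesianProduct (tabulate (λ i → f (suc i))) ys

module _ {n : ℕ} (G : Graph n) where

  deg : Fin n → ℕ
  deg v = count (adj G v)

  private
    _<ᵇ_ : Fin n → Fin n → Bool
    i <ᵇ j = does (toℕ i <? toℕ j)

    edgesFrom edgesTo : Fin n → ℕ
    edgesFrom i = count (λ j → i <ᵇ j ∧ adj G i j)
    edgesTo   i = count (λ j → j <ᵇ i ∧ adj G i j)

    numEdges≡∑edgesFrom : numEdges G ≡ sum edgesFrom
    numEdges≡∑edgesFrom = trans (length-filter-cartesianProduct P? id (allFin n)) (sum-cong-≗ λ i →
        trans (cong (λ l → length (filter P? l)) (map-tabulate id (i ,_)))
              (length-filter-tabulate P? (i ,_)))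
      where
      P? = λ { (u , v) → (toℕ u <? toℕ v) ×-dec T? (adj G u v) }

    adj-split : ∀ i j → (if adj G i j then 1 else 0)
                      ≡ (if i <ᵇ j ∧ adj G i j then 1 else 0)
                        + (if j <ᵇ i ∧ adj G i j then 1 else 0)
    adj-split i j with <-cmp (toℕ i) (toℕ j)
    ... | tri< i<j _ _
      rewrite dec-true (toℕ i <? toℕ j) i<j | dec-false (toℕ j <? toℕ i) (<-asym i<j)
      = ≡.sym (+-identityʳ _)
    ... | tri> _ _ j<i
      rewrite dec-false (toℕ i <? toℕ j) (<-asym j<i) | dec-true (toℕ j <? toℕ i) j<i = refl
    ... | tri≈ _ i≡j _ with toℕ-injective i≡j
    ...   | refl rewrite dec-false (toℕ i <? toℕ i) (<-irrefl refl) | irrefl G i = refl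

    deg≡edgesFrom+edgesTo : ∀ i → deg i ≡ edgesFrom i + edgesTo i
    deg≡edgesFrom+edgesTo i = trans (sum-cong-≗ (adj-split i))
      (∑-distrib-+ (λ j → if i <ᵇ j ∧ adj G i j then 1 else 0)
                   (λ j → if j <ᵇ i ∧ adj G i j then 1 else 0))

    ∑edgesTo≡∑edgesFrom : sum edgesTo ≡ sum edgesFrom
    ∑edgesTo≡∑edgesFrom = trans (∑-comm (λ i j → if j <ᵇ i ∧ adj G i j then 1 else 0))
      (sum-cong-≗ λ j → sum-cong-≗ λ i →
        cong (λ b → if j <ᵇ i ∧ b then 1 else 0) (sym G i j))

  handshake : sum deg ≡ 2 * numEdges G
  handshake = begin
    sum deg                                ≡⟨ sum-cong-≗ deg≡edgesFrom+edgesTo ⟩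
    sum (λ i → edgesFrom i + edgesTo i)    ≡⟨ ∑-distrib-+ edgesFrom edgesTo ⟩
    sum edgesFrom + sum edgesTo            ≡⟨ cong (sum edgesFrom +_) ∑edgesTo≡∑edgesFrom ⟩
    sum edgesFrom + sum edgesFrom          ≡⟨ cong (λ e → e + e) numEdges≡∑edgesFrom ⟨
    numEdges G + numEdges G                ≡⟨ cong (numEdges G +_) (+-identityʳ _) ⟨
    2 * numEdges G                         ∎
    where open ≡-Reasoning

  adj⇒≢ : ∀ {u v} → adj G u v ≡ true → u ≢ v
  adj⇒≢ {u} uv refl = case trans (≡.sym uv) (irrefl G u) of λ ()

  adj-sym : ∀ {u v} → adj G u v ≡ true → adj G v u ≡ true
  adj-sym {u} {v} uv = trans (sym G v u) uv

  IsTransversalᵇ : (Fin n → Bool) → Set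
  IsTransversalᵇ S = ∀ u v → adj G u v ≡ true → S u ≡ true ⊎ S v ≡ true

  IsTotalᵇ : (Fin n → Bool) → Set
  IsTotalᵇ S = ∀ v → S v ≡ true → ∃[ u ] (S u ≡ true × adj G v u ≡ true)

  IsTotalTransversalᵇ : (Fin n → Bool) → Set
  IsTotalTransversalᵇ S = IsTransversalᵇ S × IsTotalᵇ S

  NeighboursIn : (Fin n → Bool) → Fin n → Set
  NeighboursIn S w = ∀ y → adj G w y ≡ true → S y ≡ true

  OtherNeighbourIn : (Fin n → Bool) → Fin n → Fin n → Set
  OtherNeighbourIn S x w = ∃[ u ] (u ≢ w × S u ≡ true × adj G x u ≡ true)

  all-isTotalTransversal : NoIsolatedVertex G → IsTotalTransversalᵇ (const true)
  all-isTotalTransversal noIsolatedVertex =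
    (λ _ _ _ → inj₁ refl) ,
    λ v _ → let u , vu = noIsolatedVertex v in u , refl , Equivalence.to T-≡ vu

  remove-isTotalTransversal : ∀ {S w} → IsTotalTransversalᵇ S →
    NeighboursIn S w → (∀ x → adj G x w ≡ true → S x ≡ true → OtherNeighbourIn S x w) →
    IsTotalTransversalᵇ (S [ w ]≔ false)
  remove-isTotalTransversal {S} {w} (transversal , total) N[w]⊆S rerouted = transversal⁻ , total⁻
    where
    kept : ∀ {y} → y ≢ w → S y ≡ true → (S [ w ]≔ false) y ≡ true
    kept {y} y≢w Sy = trans (updateAt-minimal y w S y≢w) Sy

    left : ∀ {y} → (S [ w ]≔ false) y ≡ true → y ≢ w × S y ≡ true
    left {y} S⁻y with y ≟ w
    ... | yes refl = case trans (≡.sym S⁻y) (updateAt-updates w S) of λ ()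
    ... | no  y≢w  = y≢w , trans (≡.sym (updateAt-minimal y w S y≢w)) S⁻y

    transversal⁻ : IsTransversalᵇ (S [ w ]≔ false)
    transversal⁻ u v uv with u ≟ w | v ≟ w
    ... | yes refl | _        = inj₂ (kept (adj⇒≢ uv ∘ ≡.sym) (N[w]⊆S v uv))
    ... | no  u≢w  | yes refl = inj₁ (kept u≢w (N[w]⊆S u (adj-sym uv)))
    ... | no  u≢w  | no  v≢w  = Data.Sum.map (kept u≢w) (kept v≢w) (transversal u v uv)

    total⁻ : IsTotalᵇ (S [ w ]≔ false)
    total⁻ x S⁻x with left S⁻x
    ... | x≢w , Sx with total x Sx
    ...   | u , Su , xu with u ≟ w
    ...     | no  u≢w  = u , kept u≢w Su , xu
    ...     | yes refl = let u′ , u′≢w , Su′ , xu′ = rerouted x xu Sx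
                         in u′ , kept u′≢w Su′ , xu′

  add-isTotalTransversal : ∀ {S b} → IsTotalTransversalᵇ S →
    ∃[ u ] (S u ≡ true × adj G b u ≡ true) → IsTotalTransversalᵇ (S [ b ]≔ true)
  add-isTotalTransversal {S} {b} (transversal , total) (u , Su , bu) = transversal⁺ , total⁺
    where
    grown : ∀ {y} → S y ≡ true → (S [ b ]≔ true) y ≡ true
    grown {y} Sy with y ≟ b
    ... | yes refl = updateAt-updates b S
    ... | no  y≢b  = trans (updateAt-minimal y b S y≢b) Sy

    transversal⁺ : IsTransversalᵇ (S [ b ]≔ true)
    transversal⁺ x y xy = Data.Sum.map grown grown (transversal x y xy)

    total⁺ : IsTotalᵇ (S [ b ]≔ true)
    total⁺ x S⁺x with x ≟ b
    ... | yes refl = u , grown Su , bu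
    ... | no  x≢b  = let v , Sv , xv = total x (trans (≡.sym (updateAt-minimal x b S x≢b)) S⁺x)
                     in v , grown Sv , xv

  degreeSum : (Fin n → Bool) → ℕ
  degreeSum S = sumOver S deg

  -- Lexicographic in (count S, - degreeSum S), since sum deg bounds every degreeSum.
  potential : (Fin n → Bool) → ℕ
  potential S = suc (sum deg) * count S + (sum deg ∸ degreeSum S)

  Improvable : (Fin n → Bool) → Set
  Improvable S = ∃[ S′ ] (IsTotalTransversalᵇ S′ × potential S′ < potential S)

  potential-mono-count : ∀ {S S′} → count S′ < count S → potential S′ < potential S
  potential-mono-count {S} {S′} #S′<#S = begin-strict
    suc D * count S′ + (D ∸ degreeSum S′) ≤⟨ +-monoʳ-≤ (suc D * count S′) (m∸n≤m D (degreeSum S′)) ⟩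
    suc D * count S′ + D                  <⟨ +-monoʳ-< (suc D * count S′) (n<1+n D) ⟩
    suc D * count S′ + suc D              ≡⟨ +-comm (suc D * count S′) (suc D) ⟩
    suc D + suc D * count S′              ≡⟨ *-suc (suc D) (count S′) ⟨
    suc D * suc (count S′)                ≤⟨ *-monoʳ-≤ (suc D) #S′<#S ⟩
    suc D * count S                       ≤⟨ m≤m+n _ _ ⟩
    potential S                           ∎
    where
    open ≤-Reasoning
    D = sum deg

  potential-mono-degreeSum : ∀ {S S′} → count S′ ≡ count S → degreeSum S < degreeSum S′ →
                             potential S′ < potential S
  potential-mono-degreeSum {S} {S′} #S′≡#S dS<dS′ rewrite #S′≡#S =
    +-monoʳ-< (suc (sum deg) * count S) (∸-monoʳ-< dS<dS′ (sumOver≤sum S′ deg))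

  removal-improves : ∀ {S w} → IsTotalTransversalᵇ S → S w ≡ true →
    NeighboursIn S w → (∀ x → adj G x w ≡ true → S x ≡ true → OtherNeighbourIn S x w) →
    Improvable S
  removal-improves {S} {w} TT Sw N[w]⊆S rerouted =
    S [ w ]≔ false , remove-isTotalTransversal TT N[w]⊆S rerouted ,
    potential-mono-count (≤-reflexive (≡.sym (count-remove S Sw)))

  swap-improves : ∀ {S a b} → IsTotalTransversalᵇ S →
    S a ≡ true → S b ≡ false → deg a < deg b →
    (∀ y → adj G a y ≡ true → y ≡ b ⊎ S y ≡ true) →
    OtherNeighbourIn S b a →
    (∀ x → adj G x a ≡ true → S x ≡ true →
       ∃[ u ] ((u ≡ b ⊎ (u ≢ a × S u ≡ true)) × adj G x u ≡ true)) →
    Improvable S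
  swap-improves {S} {a} {b} TT Sa Sb da<db N[a]⊆S+b (u , u≢a , Su , bu) rerouted =
    S′ , remove-isTotalTransversal TT⁺ N[a]⊆S⁺ rerouted⁺ ,
    potential-mono-degreeSum #S′≡#S dS<dS′
    where
    S⁺ = S [ b ]≔ true
    S′ = S⁺ [ a ]≔ false

    grown : ∀ {y} → S y ≡ true → S⁺ y ≡ true
    grown {y} Sy = trans (updateAt-minimal y b S (∈∉⇒≢ S Sy Sb)) Sy

    TT⁺ : IsTotalTransversalᵇ S⁺
    TT⁺ = add-isTotalTransversal TT (u , Su , bu)

    N[a]⊆S⁺ : NeighboursIn S⁺ a
    N[a]⊆S⁺ y ay with N[a]⊆S+b y ay
    ... | inj₁ refl = updateAt-updates b S
    ... | inj₂ Sy   = grown Sy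

    rerouted⁺ : ∀ x → adj G x a ≡ true → S⁺ x ≡ true → OtherNeighbourIn S⁺ x a
    rerouted⁺ x xa S⁺x with x ≟ b
    ... | yes refl = u , u≢a , grown Su , bu
    ... | no  x≢b  with rerouted x xa (trans (≡.sym (updateAt-minimal x b S x≢b)) S⁺x)
    ...   | v , inj₁ refl , xv       = b , ∈∉⇒≢ S Sa Sb ∘ ≡.sym , updateAt-updates b S , xv
    ...   | v , inj₂ (v≢a , Sv) , xv = v , v≢a , grown Sv , xv

    #S′≡#S : count S′ ≡ count S
    #S′≡#S = suc-injective (begin
      suc (count S′) ≡⟨ count-remove S⁺ (grown Sa) ⟨
      count S⁺       ≡⟨ sumOver-insert S (const 1) Sb ⟨
      suc (count S)  ∎)
      where open ≡-Reasoning

    dS<dS′ : degreeSum S < degreeSum S′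
    dS<dS′ = +-cancelˡ-< (deg a) (degreeSum S) (degreeSum S′) (begin-strict
      deg a + degreeSum S  <⟨ +-monoˡ-< (degreeSum S) da<db ⟩
      deg b + degreeSum S  ≡⟨ sumOver-insert S deg Sb ⟩
      degreeSum S⁺         ≡⟨ sumOver-remove S⁺ deg (grown Sa) ⟩
      deg a + degreeSum S′ ∎)
      where open ≤-Reasoning

  inNbrs outNbrs : (Fin n → Bool) → Fin n → Fin n → Bool
  inNbrs  S v u = adj G v u ∧ S u
  outNbrs S v u = adj G v u ∧ not (S u)

  degIn degOut : (Fin n → Bool) → Fin n → ℕ
  degIn  S v = count (inNbrs S v)
  degOut S v = count (outNbrs S v)

  degIn+degOut : ∀ S v → degIn S v + degOut S v ≡ deg v
  degIn+degOut S v = count-split (adj G v) S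

  degIn≤deg : ∀ S v → degIn S v ≤ deg v
  degIn≤deg S v = subst (degIn S v ≤_) (degIn+degOut S v) (m≤m+n (degIn S v) (degOut S v))

  deg-pos : ∀ {v u} → adj G v u ≡ true → 1 ≤ deg v
  deg-pos {v} vu = ∈⇒count-pos (adj G v) vu

  degIn-pos : ∀ {S v u} → adj G v u ≡ true → S u ≡ true → 1 ≤ degIn S v
  degIn-pos {S} {v} vu Su = ∈⇒count-pos (inNbrs S v) (∧-intro vu Su)

  total⇒degIn-pos : ∀ {S v} → IsTotalᵇ S → S v ≡ true → 1 ≤ degIn S v
  total⇒degIn-pos total Sv = let u , Su , vu = total _ Sv in degIn-pos vu Su

  degIn≡1⇒unique : ∀ {S v x y} → degIn S v ≡ 1 →
    adj G v x ≡ true → S x ≡ true → adj G v y ≡ true → S y ≡ true → x ≡ y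
  degIn≡1⇒unique {S} {v} one vx Sx vy Sy =
    count≡1⇒unique (inNbrs S v) one (∧-intro vx Sx) (∧-intro vy Sy)

  degOut≡1⇒unique : ∀ {S v x y} → degOut S v ≡ 1 →
    adj G v x ≡ true → S x ≡ false → adj G v y ≡ true → S y ≡ false → x ≡ y
  degOut≡1⇒unique {S} {v} one vx Sx vy Sy =
    count≡1⇒unique (outNbrs S v) one (∧-intro vx (cong not Sx)) (∧-intro vy (cong not Sy))

  degIn≥2⇒other : ∀ {S v} → 2 ≤ degIn S v → ∀ y → OtherNeighbourIn S v y
  degIn≥2⇒other {S} {v} 2≤ y =
    let u , u≢y , vu∧Su = count≥2⇒other (inNbrs S v) 2≤ y
        vu , Su = ∧-elim vu∧Su
    in u , u≢y , Su , vu

  degOut-pos⇒∃ : ∀ {S v} → 1 ≤ degOut S v → ∃[ i ] (adj G v i ≡ true × S i ≡ false)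
  degOut-pos⇒∃ {S} {v} 1≤ =
    let i , vi∧¬Si = count-pos⇒∈ (outNbrs S v) 1≤ in i , ∧-not-elim vi∧¬Si

  degOut≡0⇒neighboursIn : ∀ {S v} → degOut S v ≡ 0 → NeighboursIn S v
  degOut≡0⇒neighboursIn {S} {v} closed y vy with S y in Sy
  ... | true  = refl
  ... | false =
    case trans (≡.sym (∧-intro vy (cong not Sy))) (count≡0⇒∉ (outNbrs S v) closed y) of λ ()

  degOut≡0⇒degIn≡deg : ∀ {S v} → degOut S v ≡ 0 → degIn S v ≡ deg v
  degOut≡0⇒degIn≡deg {S} {v} closed =
    trans (≡.sym (+-identityʳ _)) (trans (cong (degIn S v +_) (≡.sym closed)) (degIn+degOut S v))

  -- What a vertex outside S of degree d sends to each of its neighbours (its budget is 2 + d).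
  token : ℕ → ℕ
  token 1 = 3
  token 2 = 2
  token _ = 1

  token-pos : ∀ d → 1 ≤ token d
  token-pos 0                   = ≤-refl
  token-pos 1                   = s≤s z≤n
  token-pos 2                   = s≤s z≤n
  token-pos (suc (suc (suc _))) = ≤-refl

  token-budget : ∀ d → token d * d ≤ 2 + d
  token-budget 0                   = z≤n
  token-budget 1                   = ≤-refl
  token-budget 2                   = ≤-refl
  token-budget (suc (suc (suc d))) = ≤-trans (≤-reflexive (*-identityˡ _)) (m≤n+m _ 2)

  fromOutside : (Fin n → Bool) → Fin n → ℕ
  fromOutside S v = sumOver (outNbrs S v) (λ u → token (deg u))

  -- Truncated subtraction: a vertex whose charge is below 5 has no surplus.
  surplus : (Fin n → Bool) → Fin n → ℕ
  surplus S v = 2 + deg v + fromOutside S v ∸ 5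

  share : (Fin n → Bool) → Fin n → ℕ
  share S w = if S w then (if degIn S w ≡ᵇ 1 then surplus S w else 0) else token (deg w)

  transfer : (Fin n → Bool) → Fin n → Fin n → ℕ
  transfer S w v = if adj G w v ∧ S v then share S w else 0

  sent received : (Fin n → Bool) → Fin n → ℕ
  sent     S w = sum (transfer S w)
  received S v = sum (λ w → transfer S w v)

  demand : Bool → ℕ
  demand b = if b then 5 else 0

  Balanced : (Fin n → Bool) → Fin n → Set
  Balanced S v = demand (S v) + sent S v ≤ 2 + deg v + received S v

  sent≡share*degIn : ∀ S w → sent S w ≡ share S w * degIn S w
  sent≡share*degIn S w = sumOver-const (inNbrs S w) (share S w)

  share-∉ : ∀ {S w} → S w ≡ false → share S w ≡ token (deg w)
  share-∉ {S} {w} Sw =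
    cong (λ b → if b then (if degIn S w ≡ᵇ 1 then surplus S w else 0) else token (deg w)) Sw

  share-∈ : ∀ {S w} → S w ≡ true → share S w ≡ (if degIn S w ≡ᵇ 1 then surplus S w else 0)
  share-∈ {S} {w} Sw =
    cong (λ b → if b then (if degIn S w ≡ᵇ 1 then surplus S w else 0) else token (deg w)) Sw

  degOut≤fromOutside : ∀ S v → degOut S v ≤ fromOutside S v
  degOut≤fromOutside S v = sumOver-monoʳ (outNbrs S v) (λ u → token-pos (deg u))

  fromOutside≤received : ∀ {S v} → S v ≡ true → fromOutside S v ≤ received S v
  fromOutside≤received {S} {v} Sv = sum-mono λ w → lemma w (adj G v w) (sym G w v) (S w) refl
    where
    lemma : ∀ w a → adj G w v ≡ a → ∀ b → S w ≡ b →
            (if a ∧ not b then token (deg w) else 0) ≤ transfer S w v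
    lemma w false _  _     _  = z≤n
    lemma w true  _  true  _  = z≤n
    lemma w true  wv false Sw = ≤-reflexive (≡.sym
      (trans (cong₂ (λ a b → if a ∧ b then share S w else 0) wv Sv) (share-∉ {S} Sw)))

  sent-∉ : ∀ {S v} → S v ≡ false → sent S v ≤ 2 + deg v
  sent-∉ {S} {v} Sv = begin
    sent S v                  ≡⟨ sent≡share*degIn S v ⟩
    share S v * degIn S v     ≡⟨ cong (_* degIn S v) (share-∉ {S} Sv) ⟩
    token (deg v) * degIn S v ≤⟨ *-monoʳ-≤ (token (deg v)) (degIn≤deg S v) ⟩
    token (deg v) * deg v     ≤⟨ token-budget (deg v) ⟩
    2 + deg v                 ∎
    where open ≤-Reasoning

  sent-∈ : ∀ {S v} → S v ≡ true → sent S v ≤ surplus S v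
  sent-∈ {S} {v} Sv = begin
    sent S v                                                ≡⟨ sent≡share*degIn S v ⟩
    share S v * degIn S v                                   ≡⟨ cong (_* degIn S v) (share-∈ {S} Sv) ⟩
    (if degIn S v ≡ᵇ 1 then surplus S v else 0) * degIn S v ≤⟨ lemma (degIn S v) ⟩
    surplus S v                                             ∎
    where
    open ≤-Reasoning
    lemma : ∀ k → (if k ≡ᵇ 1 then surplus S v else 0) * k ≤ surplus S v
    lemma 0             = z≤n
    lemma 1             = ≤-reflexive (*-identityʳ _)
    lemma (suc (suc k)) = z≤n

  balanced-∉ : ∀ {S v} → S v ≡ false → Balanced S v
  balanced-∉ {S} {v} Sv = subst (λ b → demand b + sent S v ≤ 2 + deg v + received S v) (≡.sym Sv)
    (≤-trans (sent-∉ Sv) (m≤m+n (2 + deg v) (received S v)))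

  -- v sends at most its charge minus 5, so it remains to see that the charge reaches 5.
  balanced-∈ : ∀ {S v} → S v ≡ true → 3 ≤ deg v + received S v → Balanced S v
  balanced-∈ {S} {v} Sv 3≤ = subst (λ b → demand b + sent S v ≤ 2 + deg v + received S v) (≡.sym Sv)
    (begin
      5 + sent S v                          ≤⟨ +-monoʳ-≤ 5 (sent-∈ Sv) ⟩
      5 + (2 + deg v + fromOutside S v ∸ 5) ≤⟨ m+[n∸m]≤o 5≤ charge≤ ⟩
      2 + deg v + received S v              ∎)
    where
    open ≤-Reasoning
    5≤ : 5 ≤ 2 + deg v + received S v
    5≤ = subst (5 ≤_) (≡.sym (+-assoc 2 (deg v) (received S v))) (+-monoʳ-≤ 2 3≤)
    charge≤ : 2 + deg v + fromOutside S v ≤ 2 + deg v + received S v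
    charge≤ = +-monoʳ-≤ (2 + deg v) (fromOutside≤received Sv)

  all-balanced⇒bound : ∀ S → (∀ v → Balanced S v) → 5 * count S ≤ 2 * n + sum deg
  all-balanced⇒bound S balanced = +-cancelʳ-≤ R (5 * count S) (2 * n + sum deg) (begin
    5 * count S + R                       ≡⟨ cong₂ _+_ (sumOver-const S 5) (∑-comm (transfer S)) ⟨
    sumOver S (const 5) + sum (sent S)    ≡⟨ ∑-distrib-+ (λ v → demand (S v)) (sent S) ⟨
    sum (λ v → demand (S v) + sent S v)   ≤⟨ sum-mono balanced ⟩
    sum (λ v → 2 + deg v + received S v)  ≡⟨ ∑-distrib-+ (λ v → 2 + deg v) (received S) ⟩
    sum (λ v → 2 + deg v) + R             ≡⟨ cong (_+ R) (∑-distrib-+ (const 2) deg) ⟩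
    sum {n} (const 2) + sum deg + R       ≡⟨ cong (λ k → k + sum deg + R) two-n ⟩
    2 * n + sum deg + R                   ∎)
    where
    open ≤-Reasoning
    R = sum (received S)
    two-n : sum {n} (const 2) ≡ 2 * n
    two-n = trans (sum-const n 2) (*-comm n 2)

  module PrivateNeighbour {S : Fin n → Bool} (TT : IsTotalTransversalᵇ S) {v t : Fin n}
    (Sv : S v ≡ true) (v-closed : degOut S v ≡ 0)
    (St : S t ≡ true) (vt : adj G v t ≡ true) (t-private : degIn S t ≡ 1)
    where

    tv : adj G t v ≡ true
    tv = adj-sym vt

    degIn-v : degIn S v ≡ deg v
    degIn-v = degOut≡0⇒degIn≡deg v-closed

    surplus≤received : surplus S t ≤ received S v
    surplus≤received = subst (_≤ received S v) transfer≡surplus (≤-sum (λ w → transfer S w v) t)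
      where
      transfer≡surplus : transfer S t v ≡ surplus S t
      transfer≡surplus = trans (cong₂ (λ a b → if a ∧ b then share S t else 0) tv Sv)
        (trans (share-∈ {S} St) (cong (λ k → if k ≡ᵇ 1 then surplus S t else 0) t-private))

    only-v : ∀ {x} → adj G t x ≡ true → S x ≡ true → x ≡ v
    only-v tx Sx = degIn≡1⇒unique t-private tx Sx tv Sv

    other-than-t : deg v ≡ 2 → OtherNeighbourIn S v t
    other-than-t dv = degIn≥2⇒other (≤-reflexive (≡.sym (trans degIn-v dv))) t

    leaf : NoIsolatedEdge G → degOut S t ≡ 0 → deg v ≡ 1 ⊎ deg v ≡ 2 → Improvable S
    leaf noIsolatedEdge t-closed (inj₁ dv) with noIsolatedEdge v t (Equivalence.from T-≡ vt)
    ... | w , inj₁ (vw , w≢t) =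
      let vw′ = Equivalence.to T-≡ vw
          Sw  = degOut≡0⇒neighboursIn v-closed w vw′
      in ⊥-elim (w≢t (degIn≡1⇒unique (trans degIn-v dv) vw′ Sw vt St))
    ... | w , inj₂ (tw , w≢v) =
      let tw′ = Equivalence.to T-≡ tw
      in ⊥-elim (w≢v (only-v tw′ (degOut≡0⇒neighboursIn t-closed w tw′)))
    leaf noIsolatedEdge t-closed (inj₂ dv) =
      removal-improves TT St (degOut≡0⇒neighboursIn t-closed) rerouted
      where
      rerouted : ∀ x → adj G x t ≡ true → S x ≡ true → OtherNeighbourIn S x t
      rerouted x xt Sx with only-v (adj-sym xt) Sx
      ... | refl = other-than-t dv

    many-outside-neighbours : 2 ≤ degOut S t → 3 ≤ deg v + surplus S t
    many-outside-neighbours 2≤out =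
      +-mono-≤ (deg-pos vt) (subst (_≤ surplus S t) (m+n∸n≡m 2 5) (∸-monoˡ-≤ 5 7≤charge))
      where
      3≤deg-t : 3 ≤ deg t
      3≤deg-t = subst (3 ≤_) (degIn+degOut S t) (+-mono-≤ (≤-reflexive (≡.sym t-private)) 2≤out)
      7≤charge : 7 ≤ 2 + deg t + fromOutside S t
      7≤charge = +-mono-≤ (+-monoʳ-≤ 2 3≤deg-t) (≤-trans 2≤out (degOut≤fromOutside S t))

    module _ (t-out : degOut S t ≡ 1) {i : Fin n} (ti : adj G t i ≡ true) (Si : S i ≡ false) where

      deg-t : deg t ≡ 2
      deg-t = trans (≡.sym (degIn+degOut S t)) (cong₂ _+_ t-private t-out)

      surplus-at : ∀ {d} → deg i ≡ d → surplus S t ≡ 4 + token d ∸ 5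
      surplus-at di = cong₂ (λ d k → 2 + d + k ∸ 5) deg-t
        (trans (sumOver-unique (outNbrs S t) (λ u → token (deg u)) t-out (∧-intro ti (cong not Si)))
               (cong token di))

      swap-v-for-i : deg v ≡ 1 → 2 ≤ deg i → Improvable S
      swap-v-for-i dv 2≤di = swap-improves TT Sv Si (subst (λ d → suc d ≤ deg i) (≡.sym dv) 2≤di)
        (λ y vy → inj₂ (degOut≡0⇒neighboursIn v-closed y vy))
        (t , adj⇒≢ tv , St , adj-sym ti)
        rerouted
        where
        rerouted : ∀ x → adj G x v ≡ true → S x ≡ true →
                   ∃[ u ] ((u ≡ i ⊎ (u ≢ v × S u ≡ true)) × adj G x u ≡ true)
        rerouted x xv Sx with degIn≡1⇒unique (trans degIn-v dv) (adj-sym xv) Sx vt St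
        ... | refl = i , inj₁ refl , ti

      swap-t-for-i : deg v ≡ 2 → 3 ≤ deg i → Improvable S
      swap-t-for-i dv 3≤di =
        swap-improves TT St Si (subst (λ d → suc d ≤ deg i) (≡.sym deg-t) 3≤di) N[t]⊆S+i i-has-other rerouted
        where
        N[t]⊆S+i : ∀ y → adj G t y ≡ true → y ≡ i ⊎ S y ≡ true
        N[t]⊆S+i y ty with S y in Sy
        ... | true  = inj₂ refl
        ... | false = inj₁ (degOut≡1⇒unique t-out ty Sy ti Si)

        i-has-other : OtherNeighbourIn S i t
        i-has-other with count≥2⇒other (adj G i) (≤-trans (s≤s (s≤s z≤n)) 3≤di) t
        ... | u , u≢t , iu with proj₁ TT i u iu
        ...   | inj₁ Si′ = case trans (≡.sym Si′) Si of λ ()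
        ...   | inj₂ Su  = u , u≢t , Su , iu

        rerouted : ∀ x → adj G x t ≡ true → S x ≡ true →
                   ∃[ u ] ((u ≡ i ⊎ (u ≢ t × S u ≡ true)) × adj G x u ≡ true)
        rerouted x xt Sx with only-v (adj-sym xt) Sx
        ... | refl = let u , u≢t , Su , xu = other-than-t dv in u , inj₂ (u≢t , Su) , xu

      one-outside-neighbour : deg v ≡ 1 ⊎ deg v ≡ 2 → 3 ≤ deg v + surplus S t ⊎ Improvable S
      one-outside-neighbour dv with 1≤⇒[≡1⊎≡2]⊎3≤ (deg-pos (adj-sym ti)) | dv
      ... | inj₁ (inj₁ di≡1) | _         = inj₁ (+-mono-≤ (deg-pos vt) (≤-reflexive (≡.sym (surplus-at di≡1))))
      ... | inj₁ (inj₂ di≡2) | inj₁ dv≡1 = inj₂ (swap-v-for-i dv≡1 (≤-reflexive (≡.sym di≡2)))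
      ... | inj₁ (inj₂ di≡2) | inj₂ dv≡2 = inj₁ (≤-reflexive (cong₂ _+_ (≡.sym dv≡2) (≡.sym (surplus-at di≡2))))
      ... | inj₂ 3≤di        | inj₁ dv≡1 = inj₂ (swap-v-for-i dv≡1 (≤-trans (n≤1+n 2) 3≤di))
      ... | inj₂ 3≤di        | inj₂ dv≡2 = inj₂ (swap-t-for-i dv≡2 3≤di)

    3≤deg+surplus⊎improvable : NoIsolatedEdge G → deg v ≡ 1 ⊎ deg v ≡ 2 →
                               3 ≤ deg v + surplus S t ⊎ Improvable S
    3≤deg+surplus⊎improvable noIsolatedEdge dv with degOut S t in out
    ... | 0           = inj₂ (leaf noIsolatedEdge out dv)
    ... | 1           = let i , ti , Si = degOut-pos⇒∃ (≤-reflexive (≡.sym out))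
                        in one-outside-neighbour out ti Si dv
    ... | suc (suc _) = inj₁ (many-outside-neighbours (subst (2 ≤_) (≡.sym out) (s≤s (s≤s z≤n))))

  privateNbrs : (Fin n → Bool) → Fin n → Fin n → Bool
  privateNbrs S v t = adj G v t ∧ (S t ∧ (degIn S t ≡ᵇ 1))

  low-degree⇒3≤deg+received⊎improvable : ∀ {S v} → IsTotalTransversalᵇ S → NoIsolatedEdge G →
    S v ≡ true → degOut S v ≡ 0 → deg v ≡ 1 ⊎ deg v ≡ 2 →
    3 ≤ deg v + received S v ⊎ Improvable S
  low-degree⇒3≤deg+received⊎improvable {S} {v} TT noIsolatedEdge Sv v-closed dv
    with count (privateNbrs S v) in #private
  ... | zero  = inj₂ (removal-improves TT Sv (degOut≡0⇒neighboursIn v-closed) rerouted)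
    where
    rerouted : ∀ x → adj G x v ≡ true → S x ≡ true → OtherNeighbourIn S x v
    rerouted x xv Sx = degIn≥2⇒other (≢ᵇ1⇒2≤ not-private (degIn-pos xv Sv)) v
      where
      not-private : (degIn S x ≡ᵇ 1) ≡ false
      not-private = trans (≡.sym (cong₂ (λ a b → a ∧ (b ∧ (degIn S x ≡ᵇ 1))) (adj-sym xv) Sx))
                          (count≡0⇒∉ (privateNbrs S v) #private x)
  ... | suc _ with count-pos⇒∈ (privateNbrs S v) (subst (0 <_) (≡.sym #private) (s≤s z≤n))
  ...   | t , private-t =
    let vt , St∧one = ∧-elim private-t
        St , one    = ∧-elim St∧one
        open PrivateNeighbour TT Sv v-closed St vt (≡ᵇ1⇒≡1 one)
    in Data.Sum.map₁ (λ 3≤ → ≤-trans 3≤ (+-monoʳ-≤ (deg v) surplus≤received))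
                     (3≤deg+surplus⊎improvable noIsolatedEdge dv)

  ∈⇒3≤deg+received⊎improvable : ∀ {S v} → IsTotalTransversalᵇ S → NoIsolatedEdge G →
    S v ≡ true → 3 ≤ deg v + received S v ⊎ Improvable S
  ∈⇒3≤deg+received⊎improvable {S} {v} TT noIsolatedEdge Sv with degOut S v in out
  ... | suc _ = inj₁ (+-mono-≤ 2≤deg 1≤received)
    where
    1≤out : 1 ≤ degOut S v
    1≤out = subst (1 ≤_) (≡.sym out) (s≤s z≤n)
    2≤deg : 2 ≤ deg v
    2≤deg = subst (2 ≤_) (degIn+degOut S v) (+-mono-≤ (total⇒degIn-pos (proj₂ TT) Sv) 1≤out)
    1≤received : 1 ≤ received S v
    1≤received = ≤-trans 1≤out (≤-trans (degOut≤fromOutside S v) (fromOutside≤received Sv))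
  ... | zero with 1≤⇒[≡1⊎≡2]⊎3≤ (≤-trans (total⇒degIn-pos (proj₂ TT) Sv) (degIn≤deg S v))
  ...   | inj₁ dv = low-degree⇒3≤deg+received⊎improvable TT noIsolatedEdge Sv out dv
  ...   | inj₂ 3≤dv = inj₁ (≤-trans 3≤dv (m≤m+n (deg v) (received S v)))

  balanced⊎improvable : ∀ {S} → IsTotalTransversalᵇ S → NoIsolatedEdge G →
                        ∀ v → Balanced S v ⊎ Improvable S
  balanced⊎improvable {S} TT noIsolatedEdge v with ≡true⊎≡false (S v)
  ... | inj₁ Sv = Data.Sum.map₁ (balanced-∈ Sv) (∈⇒3≤deg+received⊎improvable TT noIsolatedEdge Sv)
  ... | inj₂ Sv = inj₁ (balanced-∉ Sv)

  improve-until-balanced : NoIsolatedEdge G → ∀ S → IsTotalTransversalᵇ S → Acc _<_ (potential S) →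
    ∃[ S′ ] (IsTotalTransversalᵇ S′ × 5 * count S′ ≤ 2 * n + sum deg)
  improve-until-balanced noIsolatedEdge S TT (acc smaller)
    with sequence-⊎ (balanced⊎improvable TT noIsolatedEdge)
  ... | inj₁ balanced          = S , TT , all-balanced⇒bound S balanced
  ... | inj₂ (S′ , TT′ , S′<S) = improve-until-balanced noIsolatedEdge S′ TT′ (smaller S′<S)

toSubset : (Fin n → Bool) → Subset n
toSubset = Vec.tabulate

∈-toSubset : ∀ (S : Fin n → Bool) {x} → S x ≡ true → x ∈ toSubset S
∈-toSubset S {x} Sx = Vec.lookup⇒[]= x (toSubset S) (trans (Vec.lookup∘tabulate S x) Sx)

∈-toSubset⁻ : ∀ (S : Fin n → Bool) {x} → x ∈ toSubset S → S x ≡ true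
∈-toSubset⁻ S {x} x∈S = trans (≡.sym (Vec.lookup∘tabulate S x)) (Vec.[]=⇒lookup x∈S)

∣toSubset∣ : (S : Fin n → Bool) → ∣ toSubset S ∣ ≡ count S
∣toSubset∣ {zero}  S = refl
∣toSubset∣ {suc n} S =
  trans (lemma (S zero)) (cong ((if S zero then 1 else 0) +_) (∣toSubset∣ (λ x → S (suc x))))
  where
  lemma : ∀ b {r} → (if does (b ≟ᵇ true) then suc else id) r ≡ (if b then 1 else 0) + r
  lemma true  = refl
  lemma false = refl

toSubset-isTotalTransversal : ∀ (G : Graph n) {S} → IsTotalTransversalᵇ G S →
                              IsTotalTransversal G (toSubset S)
toSubset-isTotalTransversal G {S} (transversal , total) = transversal′ , total′
  where
  transversal′ : IsTransversal G (toSubset S)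
  transversal′ u v uv =
    Data.Sum.map (∈-toSubset S) (∈-toSubset S) (transversal u v (Equivalence.to T-≡ uv))
  total′ : IsTotal G (toSubset S)
  total′ v v∈S = let u , Su , vu = total v (∈-toSubset⁻ S v∈S)
                 in u , ∈-toSubset S Su , Equivalence.from T-≡ vu

theorem5p1 : ∀ (n : ℕ) (G : Graph n) → InH2 G →
    ∃[ S ] (IsTotalTransversal G S × 5 * ∣ S ∣ ≤ 2 * (n + numEdges G))
theorem5p1 n G (noIsolatedVertex , noIsolatedEdge)
  with improve-until-balanced G noIsolatedEdge (const true) (all-isTotalTransversal G noIsolatedVertex)
                              (<-wellFounded _)
... | S , TT , 5#S≤ = toSubset S , toSubset-isTotalTransversal G TT , (begin
  5 * ∣ toSubset S ∣     ≡⟨ cong (5 *_) (∣toSubset∣ S) ⟩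
  5 * count S            ≤⟨ 5#S≤ ⟩
  2 * n + sum (deg G)    ≡⟨ cong (2 * n +_) (handshake G) ⟩
  2 * n + 2 * numEdges G ≡⟨ *-distribˡ-+ 2 n (numEdges G) ⟨
  2 * (n + numEdges G)   ∎)
  where open ≤-Reasoning
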